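{- Let $n\in\mathbb{N}$, $\pi\in S_n'$ and $x,y\in[n]$. If $T_\pi(x)\ge_D T_\pi(y)$, then $x\ge y$.
   Context: A "permutation" may be any finite sequence of distinct integers. West's stack-sorting map $s$: read the input left to right with an initially empty stack; repeatedly, if the input is nonempty and either the stack is empty or the top of the stack is greater than the next input entry, push the next entry; otherwise pop the top of the stack and append it to the output; stop when input and stack are empty. $\operatorname{sc}(\pi)$ is the least $k\ge0$ with $s^k(\pi)$ increasing. $S_n'$ is the set of permutations of $\{0,1,\dots,n\}$ whose last entry is $0$. For $\pi\in S_n'$ and $1\le i\le\operatorname{sc}(\pi)$ let $\sigma=s^{i-1}(\pi)$. Let $c_{\pi,i,1}$ be the maximum of the entries of $\sigma$ strictly left of $0$; for $j\ge2$, as long as some entry of $\sigma$ lies strictly between $c_{\pi,i,j-1}$ and $0$, let $c_{\pi,i,j}$ be the maximum of those entries; otherwise stop. This gives $C_{\pi,i}=(c_{\pi,i,1},\dots,c_{\pi,i,|C_{\pi,i}|})$. Blocks: $b_{\pi,i,1}$ is the contiguous subsequence of $\sigma$ strictly before $c_{\pi,i,1}$, and $b_{\pi,i,j}$ ($j\ge2$) the contiguous subsequence strictly between $c_{\pi,i,j-1}$ and $c_{\pi,i,j}$. Every $x\in[n]$ equals $c_{\pi,i,j}$ for a unique pair $(i,j)$; set $\operatorname{col}_\pi(x)=i$, $\operatorname{colpos}_\pi(x)=j$. If $\operatorname{col}_\pi(x)>1$, there is a unique $j$ with $x=\max(b_{\pi,\operatorname{col}_\pi(x)-1,j})$, and $\operatorname{leftof}_\pi(x):=c_{\pi,\operatorname{col}_\pi(x)-1,j}$.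 Recursively $\operatorname{row}_\pi(x)=\operatorname{colpos}_\pi(x)$ if $\operatorname{col}_\pi(x)=1$, and $\operatorname{row}_\pi(x)=\operatorname{row}_\pi(\operatorname{leftof}_\pi(x))$ otherwise. The composition $\alpha_\pi=(|\{x\in[n]:\operatorname{row}_\pi(x)=j\}|)_{j=1}^{|C_{\pi,1}|}$ is a composition of $n$. For a composition $\alpha=(\alpha_1,\dots,\alpha_k)$, $D(\alpha)=\{(i,j)\in\mathbb{N}^2: 1\le j\le k,\ i\le\alpha_j\}$, partially ordered by $(a,b)\ge_D(c,d)$ iff $a\le c$ and $b\le d$. The stack-sorting tableau is $T_\pi:[n]\to D(\alpha_\pi)$, $T_\pi(x)=(\operatorname{col}_\pi(x),\operatorname{row}_\pi(x))$. -}

module Defs where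

open import Data.Nat using (ℕ; zero; suc; _≤_; _<_; _<ᵇ_; _≤ᵇ_; _⊔_; _≡ᵇ_)
open import Data.Bool using (Bool; true; false; if_then_else_; _∧_; not)
open import Data.List using (List; []; _∷_; _++_; length; foldr; upTo; [_])
open import Data.Maybe using (Maybe; just; nothing)
open import Data.Product using (_×_; _,_; ∃; proj₁; proj₂)
open import Data.List.Relation.Binary.Permutation.Propositional using (_↭_)
open import Relation.Binary.PropositionalEquality using (_≡_)

IsSn' : ℕ → List ℕ → Set
IsSn' n π = (π ↭ upTo (suc n)) × ∃ λ ρ → π ≡ ρ ++ [ 0 ]

-- West's stack-sorting map, run literally as the stack machine.
-- The stack is a list with its top at the head.

popWhile : ℕ → List ℕ → List ℕ × List ℕ
popWhile x [] = [] , []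
popWhile x (t ∷ st) with x <ᵇ t
... | true  = [] , t ∷ st
... | false with popWhile x st
...   | o , r = t ∷ o , r

run : List ℕ → List ℕ → List ℕ
run [] st = st
run (x ∷ xs) st with popWhile x st
... | o , r = o ++ run xs (x ∷ r)

s : List ℕ → List ℕ
s π = run π []

iter : ℕ → List ℕ → List ℕ
iter zero π = π
iter (suc k) π = s (iter k π)

isIncreasing : List ℕ → Bool
isIncreasing [] = true
isIncreasing (x ∷ []) = true
isIncreasing (x ∷ y ∷ xs) = (x <ᵇ y) ∧ isIncreasing (y ∷ xs)

scSearch : ℕ → ℕ → List ℕ → ℕ
scSearch fuel k σ with isIncreasing σ
... | true = k
scSearch zero k σ | false = k
scSearch (suc f) k σ | false = scSearch f (suc k) (s σ)

-- sc(π): the least k ≥ 0 with s^k(π) increasing.  The search bound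
-- length π suffices since s^(m-1) sorts every list of length m.
sc : List ℕ → ℕ
sc π = scSearch (length π) 0 π

maxL : List ℕ → ℕ
maxL = foldr _⊔_ 0

leftOfZero : List ℕ → List ℕ
leftOfZero [] = []
leftOfZero (x ∷ xs) = if x ≡ᵇ 0 then [] else x ∷ leftOfZero xs

splitAtVal : ℕ → List ℕ → List ℕ × List ℕ
splitAtVal m [] = [] , []
splitAtVal m (x ∷ xs) with x ≡ᵇ m
... | true = [] , xs
... | false with splitAtVal m xs
...   | b , a = x ∷ b , a

-- Given the segment L of σ strictly between c_{j-1} (or the start) and 0,
-- produce the list of pairs (b_j , c_j), (b_{j+1}, c_{j+1}), ...:
-- c_j = max L, b_j = part of L before c_j, then continue with the part
-- of L after c_j.  (fuel = length L suffices; each step shortens L.)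
chainF : ℕ → List ℕ → List (List ℕ × ℕ)
chainF zero L = []
chainF (suc f) [] = []
chainF (suc f) (x ∷ xs) with splitAtVal (maxL (x ∷ xs)) (x ∷ xs)
... | b , a = (b , maxL (x ∷ xs)) ∷ chainF f a

chain : List ℕ → List (List ℕ × ℕ)
chain σ = chainF (length (leftOfZero σ)) (leftOfZero σ)

-- C_{π,i} and blocks for σ = s^{i-1}(π)  (i ≥ 1; index i-1 is passed)
chainAt : List ℕ → ℕ → List (List ℕ × ℕ)
chainAt π i-1 = chain (iter i-1 π)

findC : ℕ → ℕ → List (List ℕ × ℕ) → Maybe ℕ
findC x j [] = nothing
findC x j ((b , c) ∷ rest) = if c ≡ᵇ x then just j else findC x (suc j) rest

findB : ℕ → List (List ℕ × ℕ) → Maybe ℕ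
findB x [] = nothing
findB x (([] , c) ∷ rest) = findB x rest
findB x ((y ∷ ys , c) ∷ rest) =
  if maxL (y ∷ ys) ≡ᵇ x then just c else findB x rest

colSearch : ℕ → ℕ → List ℕ → ℕ → Maybe (ℕ × ℕ)
colSearch zero k π x = nothing
colSearch (suc f) k π x with findC x 1 (chainAt π k)
... | just j = just (suc k , j)
... | nothing = colSearch f (suc k) π x

colColpos : List ℕ → ℕ → Maybe (ℕ × ℕ)
colColpos π x = colSearch (sc π) 0 π x

leftof : List ℕ → ℕ → Maybe ℕ
leftof π x with colColpos π x
... | just (suc (suc i-2) , _) = findB x (chainAt π i-2)
... | _ = nothing

-- row with fuel (col decreases by one at each recursive step)
rowF : ℕ → List ℕ → ℕ → Maybe ℕ
rowF fuel π x with colColpos π x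
... | just (1 , j) = just j
rowF (suc f) π x | just (suc (suc _) , _) with leftof π x
... | just z = rowF f π z
... | nothing = nothing
rowF _ π x | _ = nothing

row : List ℕ → ℕ → Maybe ℕ
row π x = rowF (length π) π x

Tab : List ℕ → ℕ → Maybe (ℕ × ℕ)
Tab π x with colColpos π x | row π x
... | just (i , _) | just r = just (i , r)
... | _ | _ = nothing

_≥D_ : ℕ × ℕ → ℕ × ℕ → Set
(a , b) ≥D (c , d) = (a ≤ c) × (b ≤ d)

{-# OPTIONS --safe #-}
-- Let σ = s^(i-1)(π) and let L be the part of σ left of 0. The sequence C_{π,i} cuts L into
-- b₁ c₁ b₂ c₂ … b_k c_k, each c_j exceeding everything after it in L. On the stack, c_j pops
-- what is left of b_j and then stays, under everything that follows, until 0 has been output;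
-- so the part of s(σ) left of 0 is s(b₁) s(b₂) … s(b_k). Hence the columns of the tableau are
-- disjoint, every entry of C_{π,i+1} is a right-to-left maximum of s(b₁) … s(b_k), and
-- leftof(x) is the c_j whose block has maximum x, so x < leftof(x).
-- The theorem follows by induction on the position of y. In column 1, colpos increases as the
-- entries decrease. If col(x) < col(y), replace y by leftof(y) > y. If col(x) = col(y) > 1 and
-- x < y, then y does not come after the right-to-left maximum x, so the block of y precedes
-- that of x and leftof(x) < leftof(y), contradicting the induction hypothesis.
module Submission where

open import Defs
open import Data.Bool using (true; false; T)
open import Data.Bool.Properties using (T-≡)
open import Data.Nat using (ℕ; zero; suc; _+_; _≤_; _<_; _<ᵇ_; _≡ᵇ_; z≤n; s≤s; s≤s⁻¹; z<s)
open import Data.Nat.Properties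
open import Data.List using (List; []; _∷_; _++_; length)
open import Data.List.Properties using (++-assoc; ++-identityʳ)
open import Data.List.Membership.Propositional using (_∈_; _∉_)
open import Data.List.Relation.Unary.Any using (here; there)
open import Data.List.Membership.Propositional.Properties using (∈-++⁻; ∈-++⁺ˡ; ∈-++⁺ʳ)
open import Data.List.Relation.Unary.All as All using (All; []; _∷_)
import Data.List.Relation.Unary.All.Properties as All
open import Data.List.Relation.Unary.Unique.Propositional using (Unique; []; _∷_)
open import Data.List.Relation.Unary.Unique.Propositional.Properties using (Unique[x∷xs]⇒x∉xs; upTo⁺)
open import Data.List.Relation.Binary.Disjoint.Propositional using (Disjoint)
open import Data.List.Relation.Binary.Subset.Propositional using (_⊆_)
open import Data.List.Relation.Binary.Subset.Propositional.Properties using (All-resp-⊇; ++⁺; ∷⁺ʳ; ⊆-reflexive; ⊆-reflexive-↭; ⊆-trans; xs⊆xs++ys; xs⊆ys++xs; xs⊆x∷xs)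
open import Data.List.Relation.Binary.Permutation.Propositional using (_↭_; ↭-refl; ↭-sym; ↭-trans; ↭-reflexive; ↭⇒↭ₛ; module PermutationReasoning)
open import Data.List.Relation.Binary.Permutation.Propositional.Properties using (shift; shifts; ++⁺ˡ)
import Data.List.Relation.Binary.Permutation.Setoid.Properties as PermSetoid
open import Data.Product using (_×_; _,_; ∃; proj₁; proj₂)
open import Data.Sum using (_⊎_; inj₁; inj₂)
open import Data.Empty using (⊥-elim)
open import Data.Maybe using (just; nothing)
open import Function using (Equivalence; _∘_)
open import Relation.Binary.PropositionalEquality

≡ᵇ-true⇒≡ : ∀ m n → (m ≡ᵇ n) ≡ true → m ≡ n
≡ᵇ-true⇒≡ m n e = ≡ᵇ⇒≡ m n (subst T (sym e) _)

≡ᵇ-false⇒≢ : ∀ m n → (m ≡ᵇ n) ≡ false → m ≢ n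
≡ᵇ-false⇒≢ m n e m≡n = subst T e (≡⇒≡ᵇ m n m≡n)

<⇒<ᵇ-true : ∀ {m n} → m < n → (m <ᵇ n) ≡ true
<⇒<ᵇ-true m<n = Equivalence.to T-≡ (<⇒<ᵇ m<n)

≥⇒<ᵇ-false : ∀ {m n} → n ≤ m → (m <ᵇ n) ≡ false
≥⇒<ᵇ-false {m} {n} n≤m with m <ᵇ n in e
... | false = refl
... | true  = ⊥-elim (≤⇒≯ n≤m (<ᵇ⇒< m n (subst T (sym e) _)))

Unique-resp-↭ : ∀ {A : Set} {xs ys : List A} → xs ↭ ys → Unique xs → Unique ys
Unique-resp-↭ {A} p = PermSetoid.Unique-resp-↭ (setoid A) (↭⇒↭ₛ p)

Unique-++⁻ : ∀ {A : Set} (xs : List A) {ys} → Unique (xs ++ ys) → Unique xs × Unique ys × Disjoint xs ys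
Unique-++⁻ [] u = [] , u , λ ()
Unique-++⁻ (x ∷ xs) (x∉ ∷ u) with Unique-++⁻ xs u
... | uxs , uys , xs#ys = All.++⁻ˡ xs x∉ ∷ uxs , uys , disjoint
  where
  disjoint : Disjoint (x ∷ xs) _
  disjoint (here refl , v∈ys) = All.lookup (All.++⁻ʳ xs x∉) v∈ys refl
  disjoint (there v∈xs , v∈ys) = xs#ys (v∈xs , v∈ys)

Unique-block⁻ : ∀ {A : Set} b {c : A} {r} → Unique (b ++ c ∷ r) → Disjoint b r × Unique r
Unique-block⁻ b u with Unique-++⁻ b u
... | _ , _ ∷ ur , b#cr = (λ (z∈b , z∈r) → b#cr (z∈b , there z∈r)) , ur

All-block⁻ : ∀ {A : Set} {P : A → Set} b {c} {r} → All P (b ++ c ∷ r) → P c × All P r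
All-block⁻ b Pbcr with All.++⁻ʳ b Pbcr
... | Pc ∷ Pr = Pc , Pr

popWhile-++ : ∀ x st {o r} → popWhile x st ≡ (o , r) → o ++ r ≡ st
popWhile-++ x [] refl = refl
popWhile-++ x (t ∷ st) eq with x <ᵇ t
popWhile-++ x (t ∷ st) refl | true = refl
... | false with popWhile x st in eq′
popWhile-++ x (t ∷ st) refl | false | o , r = cong (t ∷_) (popWhile-++ x st eq′)

popWhile-rest : ∀ {P : ℕ → Set} {x} st {o r} → All P st → popWhile x st ≡ (o , r) → All P r
popWhile-rest {x = x} st {o} Pst eq = All.++⁻ʳ o (subst (All _) (sym (popWhile-++ x st eq)) Pst)

run-↭ : ∀ L st → run L st ↭ L ++ st
run-↭ [] st = ↭-refl
run-↭ (x ∷ xs) st with popWhile x st in eq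
... | o , r = begin
  o ++ run xs (x ∷ r)     ↭⟨ ++⁺ˡ o (run-↭ xs (x ∷ r)) ⟩
  o ++ xs ++ x ∷ r        ↭⟨ shifts o xs ⟩
  xs ++ o ++ x ∷ r        ≡⟨ ++-assoc xs o (x ∷ r) ⟨
  (xs ++ o) ++ x ∷ r      ↭⟨ shift x (xs ++ o) r ⟩
  x ∷ (xs ++ o) ++ r      ≡⟨ cong (x ∷_) (++-assoc xs o r) ⟩
  x ∷ xs ++ o ++ r        ≡⟨ cong (λ st′ → x ∷ xs ++ st′) (popWhile-++ x st eq) ⟩
  x ∷ xs ++ st            ∎
  where open PermutationReasoning

s-↭ : ∀ σ → s σ ↭ σ
s-↭ σ = ↭-trans (run-↭ σ []) (↭-reflexive (++-identityʳ σ))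

s⊆ : ∀ b → s b ⊆ b
s⊆ b = ⊆-reflexive-↭ (s-↭ b)

⊆s : ∀ b → b ⊆ s b
⊆s b = ⊆-reflexive-↭ (↭-sym (s-↭ b))

iter-↭ : ∀ k σ → iter k σ ↭ σ
iter-↭ zero σ = ↭-refl
iter-↭ (suc k) σ = ↭-trans (s-↭ (iter k σ)) (iter-↭ k σ)

popWhile-below : ∀ {x} st → All (_< x) st → popWhile x st ≡ (st , [])
popWhile-below [] [] = refl
popWhile-below {x} (t ∷ st) (t<x ∷ st<x)
  rewrite ≥⇒<ᵇ-false (<⇒≤ t<x) | popWhile-below st st<x = refl

popWhile-++-above : ∀ {x} st′ st {o r} → All (x <_) st → popWhile x st′ ≡ (o , r) →
                    popWhile x (st′ ++ st) ≡ (o , r ++ st)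
popWhile-++-above [] [] _ refl = refl
popWhile-++-above [] (t ∷ st) (x<t ∷ _) refl rewrite <⇒<ᵇ-true x<t = refl
popWhile-++-above {x} (t ∷ st′) st x<st eq with x <ᵇ t
popWhile-++-above (t ∷ st′) st x<st refl | true = refl
... | false with popWhile x st′ in eq′
popWhile-++-above (t ∷ st′) st x<st refl | false | o , r
  rewrite popWhile-++-above st′ st x<st eq′ = refl

popWhile-above : ∀ {x} st → All (x <_) st → popWhile x st ≡ ([] , st)
popWhile-above st x<st = popWhile-++-above [] st x<st refl

run-barrier : ∀ b c R st′ st → All (_< c) b → All (_< c) st′ → All (c <_) st →
              run (b ++ c ∷ R) (st′ ++ st) ≡ run b st′ ++ run R (c ∷ st)
run-barrier [] c R st′ st _ st′<c c<st
  rewrite popWhile-++-above st′ st c<st (popWhile-below st′ st′<c) = refl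
run-barrier (x ∷ b) c R st′ st (x<c ∷ b<c) st′<c c<st with popWhile x st′ in eq
... | o , r
  rewrite popWhile-++-above st′ st (All.map (<-trans x<c) c<st) eq
        | run-barrier b c R (x ∷ r) st b<c (x<c ∷ popWhile-rest st′ st′<c eq) c<st
  = sym (++-assoc o (run b (x ∷ r)) (run R (c ∷ st)))

run-after-0 : ∀ R st → ∃ λ T → run R (0 ∷ st) ≡ 0 ∷ T
run-after-0 [] st = st , refl
run-after-0 (y ∷ R) st with popWhile y st
... | o , r = o ++ run R (y ∷ r) , refl

leftOfZero-split : ∀ σ → 0 ∈ σ → ∃ λ R → σ ≡ leftOfZero σ ++ 0 ∷ R
leftOfZero-split (zero ∷ σ) _ = σ , refl
leftOfZero-split (suc x ∷ σ) (there 0∈σ) with leftOfZero-split σ 0∈σ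
... | R , eq = R , cong (suc x ∷_) eq

leftOfZero-positive : ∀ σ → All (0 <_) (leftOfZero σ)
leftOfZero-positive [] = []
leftOfZero-positive (zero ∷ σ) = []
leftOfZero-positive (suc x ∷ σ) = z<s ∷ leftOfZero-positive σ

leftOfZero-++ : ∀ X R → All (0 <_) X → leftOfZero (X ++ 0 ∷ R) ≡ X
leftOfZero-++ [] R [] = refl
leftOfZero-++ (suc x ∷ X) R (_ ∷ 0<X) = cong (suc x ∷_) (leftOfZero-++ X R 0<X)

maxL-∈ : ∀ x xs → maxL (x ∷ xs) ∈ x ∷ xs
maxL-∈ x [] rewrite ⊔-identityʳ x = here refl
maxL-∈ x (y ∷ xs) with ⊔-sel x (maxL (y ∷ xs))
... | inj₁ eq rewrite eq = here refl
... | inj₂ eq rewrite eq = there (maxL-∈ y xs)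

xs≤maxL : ∀ L → All (_≤ maxL L) L
xs≤maxL [] = []
xs≤maxL (x ∷ L) =
  m≤m⊔n x (maxL L) ∷ All.map (λ z≤ → ≤-trans z≤ (m≤n⊔m x (maxL L))) (xs≤maxL L)

All-<-maxL : ∀ L {xs} → xs ⊆ L → maxL L ∉ xs → All (_< maxL L) xs
All-<-maxL L xs⊆L m∉xs = All.tabulate λ {z} z∈xs →
  ≤∧≢⇒< (All.lookup (xs≤maxL L) (xs⊆L z∈xs)) (λ z≡m → m∉xs (subst (_∈ _) z≡m z∈xs))

splitAtVal-∈ : ∀ m L {b a} → m ∈ L → splitAtVal m L ≡ (b , a) → L ≡ b ++ m ∷ a
splitAtVal-∈ m (x ∷ xs) m∈L eq with x ≡ᵇ m in x≟m
splitAtVal-∈ m (x ∷ xs) _ refl | true = cong (_∷ xs) (≡ᵇ-true⇒≡ x m x≟m)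
... | false with splitAtVal m xs in eq′
splitAtVal-∈ m (x ∷ xs) (here refl) refl | false | _ = ⊥-elim (≡ᵇ-false⇒≢ m m x≟m refl)
splitAtVal-∈ m (x ∷ xs) (there m∈xs) refl | false | _ = cong (x ∷_) (splitAtVal-∈ m xs m∈xs eq′)

length-suffix : ∀ b {m : ℕ} {a} → length a < length (b ++ m ∷ a)
length-suffix [] = ≤-refl
length-suffix (x ∷ b) = m<n⇒m<1+n (length-suffix b)

splitAtMax : ∀ x xs {b a} → splitAtVal (maxL (x ∷ xs)) (x ∷ xs) ≡ (b , a) →
             x ∷ xs ≡ b ++ maxL (x ∷ xs) ∷ a × length a ≤ length xs
splitAtMax x xs {b} {a} eq =
  L≡ , s≤s⁻¹ (subst (λ L → length a < length L) (sym L≡) (length-suffix b))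
  where
  L≡ = splitAtVal-∈ _ _ (maxL-∈ x xs) eq

-- A chain is the list of pairs (b_j , c_j) of the paper, as computed by chain and chainAt;
-- its maxima form C_{π,i}.
Chain : Set
Chain = List (List ℕ × ℕ)

flatten : Chain → List ℕ
flatten [] = []
flatten ((b , c) ∷ r) = b ++ c ∷ flatten r

maxima : Chain → List ℕ
maxima [] = []
maxima ((b , c) ∷ r) = c ∷ maxima r

sortedBlocks : Chain → List ℕ
sortedBlocks [] = []
sortedBlocks ((b , c) ∷ r) = s b ++ sortedBlocks r

sortedBlocks⊆flatten : ∀ ch → sortedBlocks ch ⊆ flatten ch
sortedBlocks⊆flatten [] = λ ()
sortedBlocks⊆flatten ((b , c) ∷ r) = ++⁺ (s⊆ b) (⊆-trans (sortedBlocks⊆flatten r) (xs⊆x∷xs _ c))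

maxima⊆flatten : ∀ ch → maxima ch ⊆ flatten ch
maxima⊆flatten [] = λ ()
maxima⊆flatten ((b , c) ∷ r) = ⊆-trans (∷⁺ʳ c (maxima⊆flatten r)) (xs⊆ys++xs _ b)

data IsChain : Chain → Set where
  [] : IsChain []
  block : ∀ {b c r} → All (_< c) b → All (_< c) (flatten r) → IsChain r → IsChain ((b , c) ∷ r)

flatten-chainF : ∀ f L → length L ≤ f → flatten (chainF f L) ≡ L
flatten-chainF zero [] _ = refl
flatten-chainF (suc f) [] _ = refl
flatten-chainF (suc f) (x ∷ xs) len with splitAtVal (maxL (x ∷ xs)) (x ∷ xs) in eq
... | b , a with splitAtMax x xs eq
... | L≡ , a≤xs = begin
  b ++ m ∷ flatten (chainF f a)  ≡⟨ cong (λ t → b ++ m ∷ t) (flatten-chainF f a a≤f) ⟩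
  b ++ m ∷ a                     ≡⟨ L≡ ⟨
  x ∷ xs                         ∎
  where
  open ≡-Reasoning
  m = maxL (x ∷ xs)
  a≤f = ≤-trans a≤xs (s≤s⁻¹ len)

chainF-isChain : ∀ f L → length L ≤ f → Unique L → IsChain (chainF f L)
chainF-isChain zero [] _ _ = []
chainF-isChain (suc f) [] _ _ = []
chainF-isChain (suc f) (x ∷ xs) len uL with splitAtVal (maxL (x ∷ xs)) (x ∷ xs) in eq
... | b , a with splitAtMax x xs eq
... | L≡ , a≤xs with Unique-++⁻ b (subst Unique L≡ uL)
... | _ , ma-unique@(_ ∷ ua) , b#ma =
  block (All-<-maxL (x ∷ xs) b⊆L (λ m∈b → b#ma (m∈b , here refl)))
        (subst (All (_< maxL (x ∷ xs))) (sym (flatten-chainF f a a≤f))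
               (All-<-maxL (x ∷ xs) a⊆L (Unique[x∷xs]⇒x∉xs ma-unique)))
        (chainF-isChain f a a≤f ua)
  where
  a≤f = ≤-trans a≤xs (s≤s⁻¹ len)
  b⊆L : b ⊆ x ∷ xs
  b⊆L = ⊆-trans (xs⊆xs++ys b _) (⊆-reflexive (sym L≡))
  a⊆L : a ⊆ x ∷ xs
  a⊆L = ⊆-trans (⊆-trans (xs⊆x∷xs a _) (xs⊆ys++xs _ b)) (⊆-reflexive (sym L≡))

flatten-chain : ∀ σ → flatten (chain σ) ≡ leftOfZero σ
flatten-chain σ = flatten-chainF _ (leftOfZero σ) ≤-refl

flatten-chain-positive : ∀ σ → All (0 <_) (flatten (chain σ))
flatten-chain-positive σ = subst (All (0 <_)) (sym (flatten-chain σ)) (leftOfZero-positive σ)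

run-chain : ∀ ch R st → IsChain ch → All (0 <_) (flatten ch) →
            All (λ t → All (_< t) (flatten ch)) st → All (0 <_) st →
            ∃ λ T → run (flatten ch ++ 0 ∷ R) st ≡ sortedBlocks ch ++ 0 ∷ T
run-chain [] R st [] _ _ 0<st rewrite popWhile-above st 0<st = run-after-0 R st
run-chain ((b , c) ∷ r) R st (block b<c r<c ch) 0<ch ch<st 0<st
  with run-chain r R (c ∷ st) ch (proj₂ (All-block⁻ b 0<ch))
         (r<c ∷ All.map (proj₂ ∘ All-block⁻ b) ch<st) (proj₁ (All-block⁻ b 0<ch) ∷ 0<st)
... | T , sorted = T , (begin
  run ((b ++ c ∷ flatten r) ++ 0 ∷ R) st        ≡⟨ cong (λ L → run L st) (++-assoc b _ (0 ∷ R)) ⟩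
  run (b ++ c ∷ flatten r ++ 0 ∷ R) ([] ++ st)  ≡⟨ run-barrier b c _ [] st b<c [] c<st ⟩
  s b ++ run (flatten r ++ 0 ∷ R) (c ∷ st)      ≡⟨ cong (s b ++_) sorted ⟩
  s b ++ sortedBlocks r ++ 0 ∷ T                ≡⟨ ++-assoc (s b) (sortedBlocks r) (0 ∷ T) ⟨
  (s b ++ sortedBlocks r) ++ 0 ∷ T              ∎)
  where
  open ≡-Reasoning
  c<st = All.map (proj₁ ∘ All-block⁻ b) ch<st

leftOfZero-s : ∀ σ → Unique (leftOfZero σ) → 0 ∈ σ → leftOfZero (s σ) ≡ sortedBlocks (chain σ)
leftOfZero-s σ u 0∈σ with leftOfZero-split σ 0∈σ
... | R , σ≡ with run-chain (chain σ) R [] (chainF-isChain _ _ ≤-refl u) (flatten-chain-positive σ) [] []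
... | T , sorted = begin
  leftOfZero (s σ)                                  ≡⟨ cong (leftOfZero ∘ s) σ≡′ ⟩
  leftOfZero (run (flatten (chain σ) ++ 0 ∷ R) [])  ≡⟨ cong leftOfZero sorted ⟩
  leftOfZero (sortedBlocks (chain σ) ++ 0 ∷ T)      ≡⟨ leftOfZero-++ _ T 0<sorted ⟩
  sortedBlocks (chain σ)                            ∎
  where
  open ≡-Reasoning
  σ≡′ = trans σ≡ (cong (_++ 0 ∷ R) (sym (flatten-chain σ)))
  0<sorted = All-resp-⊇ (sortedBlocks⊆flatten (chain σ)) (flatten-chain-positive σ)

sortedBlocks-maxima-disjoint : ∀ {ch} → IsChain ch → Unique (flatten ch) →
                               Disjoint (sortedBlocks ch) (maxima ch)
sortedBlocks-maxima-disjoint {(b , c) ∷ r} (block b<c r<c ch) u (z∈S , z∈C)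
  with ∈-++⁻ (s b) z∈S | z∈C
... | inj₁ z∈b | here refl = <-irrefl refl (All.lookup b<c (s⊆ b z∈b))
... | inj₁ z∈b | there z∈Cr = proj₁ (Unique-block⁻ b u) (s⊆ b z∈b , maxima⊆flatten r z∈Cr)
... | inj₂ z∈sr | here refl = <-irrefl refl (All.lookup r<c (sortedBlocks⊆flatten r z∈sr))
... | inj₂ z∈sr | there z∈Cr =
  sortedBlocks-maxima-disjoint ch (proj₂ (Unique-block⁻ b u)) (z∈sr , z∈Cr)

data RLMax (x : ℕ) : List ℕ → Set where
  here  : ∀ {ys} → All (_< x) ys → RLMax x (x ∷ ys)
  there : ∀ {y ys} → RLMax x ys → RLMax x (y ∷ ys)

RLMax⇒∈ : ∀ {x ys} → RLMax x ys → x ∈ ys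
RLMax⇒∈ (here _) = here refl
RLMax⇒∈ (there rl) = there (RLMax⇒∈ rl)

RLMax-++⁺ʳ : ∀ {x} xs {ys} → RLMax x ys → RLMax x (xs ++ ys)
RLMax-++⁺ʳ [] rl = rl
RLMax-++⁺ʳ (_ ∷ xs) rl = there (RLMax-++⁺ʳ xs rl)

RLMax-++⁻ : ∀ {x} xs {ys} → RLMax x (xs ++ ys) → All (_< x) ys ⊎ RLMax x ys
RLMax-++⁻ [] rl = inj₂ rl
RLMax-++⁻ (_ ∷ xs) (here ys<x) = inj₁ (All.++⁻ʳ xs ys<x)
RLMax-++⁻ (_ ∷ xs) (there rl) = RLMax-++⁻ xs rl

RLMax-++⁻ʳ : ∀ {x} xs {ys} → x ∈ ys → RLMax x (xs ++ ys) → RLMax x ys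
RLMax-++⁻ʳ xs x∈ys rl with RLMax-++⁻ xs rl
... | inj₁ ys<x = ⊥-elim (<-irrefl refl (All.lookup ys<x x∈ys))
... | inj₂ rl′ = rl′

maxima-RLMax : ∀ {ch x} → IsChain ch → x ∈ maxima ch → RLMax x (flatten ch)
maxima-RLMax {(b , c) ∷ r} (block _ r<c _) (here refl) = RLMax-++⁺ʳ b (here r<c)
maxima-RLMax {(b , c) ∷ r} (block _ _ ch) (there x∈C) = RLMax-++⁺ʳ b (there (maxima-RLMax ch x∈C))

findC-just⇒∈maxima : ∀ l {x k j} → findC x k l ≡ just j → x ∈ maxima l
findC-just⇒∈maxima ((b , c) ∷ r) {x} eq with c ≡ᵇ x in c≟x
... | true = here (sym (≡ᵇ-true⇒≡ c x c≟x))
... | false = there (findC-just⇒∈maxima r eq)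

∉⇒findC-nothing : ∀ l {x k} → x ∉ maxima l → findC x k l ≡ nothing
∉⇒findC-nothing [] _ = refl
∉⇒findC-nothing ((b , c) ∷ r) {x} x∉ with c ≡ᵇ x in c≟x
... | true = ⊥-elim (x∉ (here (sym (≡ᵇ-true⇒≡ c x c≟x))))
... | false = ∉⇒findC-nothing r (λ x∈ → x∉ (there x∈))

∈⇒findC-just : ∀ l {x k} → x ∈ maxima l → ∃ λ j → findC x k l ≡ just j
∈⇒findC-just ((b , c) ∷ r) {x} {k} x∈ with c ≡ᵇ x in c≟x | x∈
... | true  | _ = k , refl
... | false | here refl = ⊥-elim (≡ᵇ-false⇒≢ c c c≟x refl)
... | false | there x∈r = ∈⇒findC-just r x∈r

findC-≥ : ∀ l {x k j} → findC x k l ≡ just j → k ≤ j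
findC-≥ ((b , c) ∷ r) {x} eq with c ≡ᵇ x
findC-≥ ((b , c) ∷ r) refl | true = ≤-refl
... | false = <⇒≤ (findC-≥ r eq)

findC-antitone : ∀ {l x y k i j} → IsChain l →
                 findC x k l ≡ just i → findC y k l ≡ just j → i ≤ j → y ≤ x
findC-antitone {(b , c) ∷ r} {x} {y} (block _ r<c ch) eqx eqy i≤j
  with c ≡ᵇ x in c≟x | c ≡ᵇ y in c≟y
... | true  | true  = ≤-reflexive (trans (sym (≡ᵇ-true⇒≡ c y c≟y)) (≡ᵇ-true⇒≡ c x c≟x))
... | true  | false = subst (y ≤_) (≡ᵇ-true⇒≡ c x c≟x)
                        (<⇒≤ (All.lookup r<c (maxima⊆flatten r (findC-just⇒∈maxima r eqy))))
findC-antitone {(b , c) ∷ r} _ eqx refl i≤j | false | true = ⊥-elim (<⇒≱ (findC-≥ r eqx) i≤j)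
... | false | false = findC-antitone ch eqx eqy i≤j

maxL≡ᵇ⇒∈ : ∀ w ws {y} → (maxL (w ∷ ws) ≡ᵇ y) ≡ true → y ∈ w ∷ ws
maxL≡ᵇ⇒∈ w ws {y} eq = subst (_∈ w ∷ ws) (≡ᵇ-true⇒≡ (maxL (w ∷ ws)) y eq) (maxL-∈ w ws)

findB-just⇒∈sortedBlocks : ∀ ch {y z} → findB y ch ≡ just z → y ∈ sortedBlocks ch
findB-just⇒∈sortedBlocks (([] , c) ∷ r) eq = findB-just⇒∈sortedBlocks r eq
findB-just⇒∈sortedBlocks ((w ∷ ws , c) ∷ r) {y} eq with maxL (w ∷ ws) ≡ᵇ y in m≟y
... | true = ∈-++⁺ˡ (⊆s (w ∷ ws) (maxL≡ᵇ⇒∈ w ws m≟y))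
... | false = ∈-++⁺ʳ (s (w ∷ ws)) (findB-just⇒∈sortedBlocks r eq)

findB-just⇒∈maxima : ∀ ch {y z} → findB y ch ≡ just z → z ∈ maxima ch
findB-just⇒∈maxima (([] , c) ∷ r) eq = there (findB-just⇒∈maxima r eq)
findB-just⇒∈maxima ((w ∷ ws , c) ∷ r) {y} eq with maxL (w ∷ ws) ≡ᵇ y
findB-just⇒∈maxima ((w ∷ ws , c) ∷ r) refl | true = here refl
... | false = there (findB-just⇒∈maxima r eq)

findB-< : ∀ {ch y z} → IsChain ch → findB y ch ≡ just z → y < z
findB-< {([] , c) ∷ r} (block _ _ ch) eq = findB-< ch eq
findB-< {(w ∷ ws , c) ∷ r} {y} (block b<c _ ch) eq with maxL (w ∷ ws) ≡ᵇ y in m≟y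
findB-< (block b<c _ _) refl | true = All.lookup b<c (maxL≡ᵇ⇒∈ _ _ m≟y)
... | false = findB-< ch eq

findB-monotone : ∀ {ch x y x′ y′} → IsChain ch → Unique (flatten ch) →
                 findB x ch ≡ just x′ → findB y ch ≡ just y′ →
                 RLMax x (sortedBlocks ch) → x < y → x′ < y′
findB-monotone {([] , c) ∷ r} (block _ _ ch) (_ ∷ u) ex ey rl x<y = findB-monotone ch u ex ey rl x<y
findB-monotone {(w ∷ ws , c) ∷ r} {x} {y} (block _ r<c ch) u ex ey rl x<y
  with maxL (w ∷ ws) ≡ᵇ x in m≟x | maxL (w ∷ ws) ≡ᵇ y in m≟y
... | true | true =
  ⊥-elim (<-irrefl (trans (sym (≡ᵇ-true⇒≡ _ x m≟x)) (≡ᵇ-true⇒≡ (maxL (w ∷ ws)) y m≟y)) x<y)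
findB-monotone {(w ∷ ws , c) ∷ r} (block _ r<c _) u ex refl rl x<y | false | true =
  All.lookup r<c (maxima⊆flatten r (findB-just⇒∈maxima r ex))
... | false | false = findB-monotone ch (proj₂ (Unique-block⁻ (w ∷ ws) u)) ex ey
                        (RLMax-++⁻ʳ (s (w ∷ ws)) (findB-just⇒∈sortedBlocks r ex) rl) x<y
... | true | false with RLMax-++⁻ (s (w ∷ ws)) rl
...   | inj₁ sr<x = ⊥-elim (<-asym x<y (All.lookup sr<x (findB-just⇒∈sortedBlocks r ey)))
...   | inj₂ rl′ = ⊥-elim (proj₁ (Unique-block⁻ (w ∷ ws) u)
                     (maxL≡ᵇ⇒∈ w ws m≟x , sortedBlocks⊆flatten r (RLMax⇒∈ rl′)))

Tab-just⁻ : ∀ π x {a b} → Tab π x ≡ just (a , b) →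
            ∃ λ j → colColpos π x ≡ just (a , j) × row π x ≡ just b
Tab-just⁻ π x tx with colColpos π x | row π x
Tab-just⁻ π x refl | just (a , j) | just b = j , refl , refl
Tab-just⁻ π x ()   | just _ | nothing
Tab-just⁻ π x ()   | nothing | _

module Tableau (π : List ℕ) (π-unique : Unique π) (0∈π : 0 ∈ π) where

  0∈iter : ∀ k → 0 ∈ iter k π
  0∈iter k = ⊆-reflexive-↭ (↭-sym (iter-↭ k π)) 0∈π

  leftOfZero-unique : ∀ k → Unique (leftOfZero (iter k π))
  leftOfZero-unique k with leftOfZero-split (iter k π) (0∈iter k)
  ... | _ , σ≡ =
    proj₁ (Unique-++⁻ _ (subst Unique σ≡ (Unique-resp-↭ (↭-sym (iter-↭ k π)) π-unique)))

  chainAt-isChain : ∀ k → IsChain (chainAt π k)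
  chainAt-isChain k = chainF-isChain _ _ ≤-refl (leftOfZero-unique k)

  flatten-chainAt-unique : ∀ k → Unique (flatten (chainAt π k))
  flatten-chainAt-unique k = subst Unique (sym (flatten-chain (iter k π))) (leftOfZero-unique k)

  flatten-chainAt-suc : ∀ k → flatten (chainAt π (suc k)) ≡ sortedBlocks (chainAt π k)
  flatten-chainAt-suc k =
    trans (flatten-chain (iter (suc k) π)) (leftOfZero-s (iter k π) (leftOfZero-unique k) (0∈iter k))

  flatten-chainAt-⊆ : ∀ {k i} → k < i → flatten (chainAt π i) ⊆ sortedBlocks (chainAt π k)
  flatten-chainAt-⊆ {k} {suc i} k<1+i with m<1+n⇒m<n∨m≡n k<1+i
  ... | inj₂ refl = ⊆-reflexive (flatten-chainAt-suc k)
  ... | inj₁ k<i = ⊆-trans (⊆-reflexive (flatten-chainAt-suc i))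
                     (⊆-trans (sortedBlocks⊆flatten (chainAt π i)) (flatten-chainAt-⊆ k<i))

  columns-disjoint : ∀ {k i x} → k < i → x ∈ maxima (chainAt π i) → x ∉ maxima (chainAt π k)
  columns-disjoint {k} {i} k<i x∈i x∈k =
    sortedBlocks-maxima-disjoint (chainAt-isChain k) (flatten-chainAt-unique k)
      (flatten-chainAt-⊆ k<i (maxima⊆flatten (chainAt π i) x∈i) , x∈k)

  maxima-suc-RLMax : ∀ {i x} → x ∈ maxima (chainAt π (suc i)) → RLMax x (sortedBlocks (chainAt π i))
  maxima-suc-RLMax {i} x∈ =
    subst (RLMax _) (flatten-chainAt-suc i) (maxima-RLMax (chainAt-isChain (suc i)) x∈)

  colSearch-sound : ∀ f k {x a j} → colSearch f k π x ≡ just (a , j) →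
                    ∃ λ i → a ≡ suc i × i < k + f × findC x 1 (chainAt π i) ≡ just j
  colSearch-sound (suc f) k {x} eq with findC x 1 (chainAt π k) in found
  colSearch-sound (suc f) k refl | just j = k , refl , m<m+n k z<s , found
  ... | nothing with colSearch-sound f (suc k) eq
  ... | i , refl , i< , found′ = i , refl , subst (i <_) (sym (+-suc k f)) i< , found′

  colSearch-complete : ∀ f k {x i j} → (∀ {l} → l < i → x ∉ maxima (chainAt π l)) →
                       findC x 1 (chainAt π i) ≡ just j → k ≤ i → i < k + f →
                       colSearch f k π x ≡ just (suc i , j)
  colSearch-complete zero k _ _ k≤i i<k+0 =
    ⊥-elim (<⇒≱ i<k+0 (subst (_≤ _) (sym (+-identityʳ k)) k≤i))
  colSearch-complete (suc f) k {x} {i} earlier found k≤i i<k+f with m≤n⇒m<n∨m≡n k≤i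
  ... | inj₂ refl rewrite found = refl
  ... | inj₁ k<i rewrite ∉⇒findC-nothing (chainAt π k) {k = 1} (earlier k<i) =
    colSearch-complete f (suc k) earlier found k<i (subst (i <_) (+-suc k f) i<k+f)

  colColpos-sound : ∀ {x a j} → colColpos π x ≡ just (a , j) →
                    ∃ λ i → a ≡ suc i × i < sc π × findC x 1 (chainAt π i) ≡ just j
  colColpos-sound = colSearch-sound (sc π) 0

  colColpos-complete : ∀ {x i} → i < sc π → x ∈ maxima (chainAt π i) →
                       ∃ λ j → colColpos π x ≡ just (suc i , j)
  colColpos-complete {i = i} i<sc x∈ with ∈⇒findC-just (chainAt π i) {k = 1} x∈
  ... | j , found = j , colSearch-complete (sc π) 0 (λ l<i → columns-disjoint l<i x∈) found z≤n i<sc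

  colColpos⇒∈maxima : ∀ {x i j} → colColpos π x ≡ just (suc i , j) → x ∈ maxima (chainAt π i)
  colColpos⇒∈maxima cx with colColpos-sound cx
  ... | _ , refl , _ , found = findC-just⇒∈maxima _ found

  -- TabPos x (i , r) is T_π(x) = (i , r), built by the recursion defining row: column i + 1
  -- is read off chainAt π i, and findB x (chainAt π i) is leftof_π(x).
  data TabPos : ℕ → ℕ × ℕ → Set where
    col₁ : ∀ {x j} → findC x 1 (chainAt π 0) ≡ just j → TabPos x (1 , j)
    colₛ : ∀ {x i z r} → x ∈ maxima (chainAt π (suc i)) → findB x (chainAt π i) ≡ just z →
           TabPos z (suc i , r) → TabPos x (suc (suc i) , r)

  leftof-findB : ∀ {x i j z} → colColpos π x ≡ just (suc (suc i) , j) → leftof π x ≡ just z →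
                 findB x (chainAt π i) ≡ just z
  leftof-findB {x} cx lx with colColpos π x | cx
  ... | _ | refl = lx

  leftof-colColpos : ∀ {x i j z} → colColpos π x ≡ just (suc (suc i) , j) →
                     findB x (chainAt π i) ≡ just z → ∃ λ jz → colColpos π z ≡ just (suc i , jz)
  leftof-colColpos cx x↦z with colColpos-sound cx
  ... | _ , refl , 1+i<sc , _ = colColpos-complete (<-trans (n<1+n _) 1+i<sc) (findB-just⇒∈maxima _ x↦z)

  rowF⇒TabPos : ∀ f {x a j b} → colColpos π x ≡ just (a , j) → rowF f π x ≡ just b →
                TabPos x (a , b)
  rowF⇒TabPos f {x} cx rx with colColpos π x in cx′ | cx
  rowF⇒TabPos f cx refl | just (1 , j) | refl with colColpos-sound cx′
  ... | _ , refl , _ , found = col₁ found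
  rowF⇒TabPos (suc f) {x} cx rx | just (suc (suc i) , j) | refl with leftof π x in lx
  ... | just z with leftof-colColpos cx′ (leftof-findB cx′ lx)
  ...   | _ , cz = colₛ (colColpos⇒∈maxima cx′) (leftof-findB cx′ lx) (rowF⇒TabPos f cz rx)
  rowF⇒TabPos (suc f) cx () | just (suc (suc i) , j) | refl | nothing
  rowF⇒TabPos zero cx () | just (suc (suc i) , j) | refl
  rowF⇒TabPos f cx () | just (zero , j) | refl

  Tab⇒TabPos : ∀ {x a b} → Tab π x ≡ just (a , b) → TabPos x (a , b)
  Tab⇒TabPos {x} tx with Tab-just⁻ π x tx
  ... | _ , cx , rx = rowF⇒TabPos (length π) cx rx

  TabPos-antitone : ∀ {x y a b c d} → TabPos x (a , b) → TabPos y (c , d) → a ≤ c → b ≤ d → y ≤ x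
  TabPos-antitone (col₁ x∈) (col₁ y∈) _ b≤d = findC-antitone (chainAt-isChain 0) x∈ y∈ b≤d
  TabPos-antitone (colₛ _ _ _) (col₁ _) (s≤s ()) _
  TabPos-antitone tx@(col₁ _) (colₛ {i = j} _ y↦y′ ty′) _ b≤d =
    ≤-trans (<⇒≤ (findB-< (chainAt-isChain j) y↦y′)) (TabPos-antitone tx ty′ (s≤s z≤n) b≤d)
  TabPos-antitone tx@(colₛ {i = i} x∈ x↦x′ tx′) (colₛ {i = j} _ y↦y′ ty′) (s≤s (s≤s i≤j)) b≤d
    with m≤n⇒m<n∨m≡n i≤j
  ... | inj₁ i<j =
    ≤-trans (<⇒≤ (findB-< (chainAt-isChain j) y↦y′)) (TabPos-antitone tx ty′ (s≤s i<j) b≤d)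
  ... | inj₂ refl = ≮⇒≥ λ x<y →
    <⇒≱ (findB-monotone (chainAt-isChain i) (flatten-chainAt-unique i) x↦x′ y↦y′
                         (maxima-suc-RLMax {i} x∈) x<y)
        (TabPos-antitone tx′ ty′ ≤-refl b≤d)

theorem3p16 : (n : ℕ) (π : List ℕ) → IsSn' n π →
    (x y : ℕ) → 1 ≤ x → x ≤ n → 1 ≤ y → y ≤ n →
    (a b c d : ℕ) → Tab π x ≡ just (a , b) → Tab π y ≡ just (c , d) →
    (a , b) ≥D (c , d) → y ≤ x
theorem3p16 n π (π↭ , ρ , π≡) x y _ _ _ _ a b c d tx ty (a≤c , b≤d) =
  TabPos-antitone (Tab⇒TabPos tx) (Tab⇒TabPos ty) a≤c b≤d
  where
  open Tableau π (Unique-resp-↭ (↭-sym π↭) (upTo⁺ (suc n)))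
                 (subst (0 ∈_) (sym π≡) (∈-++⁺ʳ ρ (here refl)))
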